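{- Let $2k+1$ be a prime, let $G$ be a finite simple graph with a $(2k+1)$-neighborhood balanced coloring, and let $v_1,\dots,v_{2k+1},v'_1,\dots,v'_{2k+1}$ be pairwise distinct vertices of $G$ such that $v_i$ and $v'_i$ have color $R_i$ for $1\le i\le 2k+1$. Let $G'$ be the graph obtained from $G$ by adding new vertices $u,a_1,a'_1,\dots,a_{2k},a'_{2k}$, where $u$ is adjacent to all of $v_1,\dots,v_{2k+1},v'_1,\dots,v'_{2k+1}$, each $a_i$ is adjacent to $v_1,\dots,v_{2k+1}$, and each $a'_i$ is adjacent to $v'_1,\dots,v'_{2k+1}$ ($1\le i\le 2k$), and extend the coloring of $G$ by giving $u$ color $R_{2k+1}$ and giving $a_i$ and $a'_i$ color $R_i$ for $1\le i\le 2k$. Then this coloring of $G'$ is a $(2k+1)$-neighborhood balanced coloring. Moreover, $G'$ has one additional vertex of one color and two additional vertices of each of the $2k$ other colors.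
   Context: For a prime $2k+1$ (with $k\ge 1$), a $(2k+1)$-neighborhood balanced coloring of a finite simple graph is an assignment to each vertex of one of $2k+1$ colors $R_1,\dots,R_{2k+1}$ such that every vertex has an equal number of neighbors of each color. The construction of $G'$ from $G$ is called a $(4k+1)$-vertex addition at $\{v_1,\dots,v_{2k+1},v'_1,\dots,v'_{2k+1}\}$. -}

module Defs where

open import Data.Nat using (ℕ; zero; suc; _+_; _*_)
open import Data.Bool using (Bool; true; false; _∧_; _∨_; if_then_else_)
open import Data.Fin using (Fin; zero; suc; splitAt; inject₁; fromℕ; _≟_)
open import Data.Sum using (_⊎_; inj₁; inj₂)
open import Data.List using (List; length; filter)
open import Data.Bool.ListAction using (any)
open import Data.List.Base using (allFin)
open import Relation.Nullary.Decidable using (⌊_⌋)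
open import Relation.Binary.PropositionalEquality using (_≡_)

IsSimple : {n : ℕ} → (Fin n → Fin n → Bool) → Set
IsSimple {n} adj = (∀ x y → adj x y ≡ adj y x) × (∀ x → adj x x ≡ false)
  where open import Data.Product using (_×_)

nbrCount : {n m : ℕ} → (Fin n → Fin n → Bool) → (Fin n → Fin m) → Fin n → Fin m → ℕ
nbrCount {n} adj col v c = length (filter (λ w → adj v w Data.Bool.≟ true) (filter (λ w → col w ≟ c) (allFin n)))
  where import Data.Bool

-- m-neighborhood balanced colouring (colours R_1..R_m are Fin m, R_{i+1} = i):
-- every vertex has the same number of neighbours of each colour.
IsBalanced : {n m : ℕ} → (Fin n → Fin n → Bool) → (Fin n → Fin m) → Set
IsBalanced {n} {m} adj col = ∀ (v : Fin n) (c c' : Fin m) → nbrCount adj col v c ≡ nbrCount adj col v c'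

classSize : {n m : ℕ} → (Fin n → Fin m) → Fin m → ℕ
classSize {n} col c = length (filter (λ w → col w ≟ c) (allFin n))

inImage : {m n : ℕ} → (Fin m → Fin n) → Fin n → Bool
inImage {m} f x = any (λ i → ⌊ f i ≟ x ⌋) (allFin m)

data Vtx (n k : ℕ) : Set where
  old : Fin n → Vtx n k
  uV  : Vtx n k
  aV  : Fin (2 * k) → Vtx n k
  a'V : Fin (2 * k) → Vtx n k

newSize : ℕ → ℕ → ℕ
newSize n k = n + suc (2 * k + 2 * k)

decode : {n k : ℕ} → Fin (newSize n k) → Vtx n k
decode {n} {k} x with splitAt n x
... | inj₁ y = old y
... | inj₂ zero = uV
... | inj₂ (suc s) with splitAt (2 * k) s
...   | inj₁ i = aV i
...   | inj₂ i = a'V i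

module Addition (n k : ℕ)
  (adj : Fin n → Fin n → Bool) (col : Fin n → Fin (suc (2 * k)))
  (v v' : Fin (suc (2 * k)) → Fin n) where

  adjV : Vtx n k → Vtx n k → Bool
  adjV (old x) (old y) = adj x y
  adjV (old x) uV      = inImage v x ∨ inImage v' x
  adjV (old x) (aV _)  = inImage v x
  adjV (old x) (a'V _) = inImage v' x
  adjV uV      (old y) = inImage v y ∨ inImage v' y
  adjV (aV _)  (old y) = inImage v y
  adjV (a'V _) (old y) = inImage v' y
  adjV _ _ = false

  colV : Vtx n k → Fin (suc (2 * k))
  colV (old x) = col x
  colV uV      = fromℕ (2 * k)
  colV (aV i)  = inject₁ i
  colV (a'V i) = inject₁ i

  adj' : Fin (newSize n k) → Fin (newSize n k) → Bool
  adj' x y = adjV (decode x) (decode y)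

  col' : Fin (newSize n k) → Fin (suc (2 * k))
  col' x = colV (decode x)

module Submission where

-- Since col ∘ v = id, the vertices v_1, …, v_{2k+1} carry every colour exactly once, and
-- likewise the v'_i; so each a_i (adjacent to all v_j) and each a'_i sees one neighbour of
-- every colour, and u sees two. An old vertex x gains neighbours only if it is some v_i
-- (or v'_i): then it gains u and all a_j (resp. a'_j), whose colours R_{2k+1}, R_1, …, R_{2k}
-- are again each colour exactly once, so all colour counts of x grow by the same amount.

open import Defs
open import Data.Nat using (ℕ; zero; suc; _+_; _*_)
open import Data.Nat.Properties using (+-assoc; +-identityʳ; +-suc; +-commutativeSemigroup)
open import Algebra.Properties.CommutativeSemigroup +-commutativeSemigroup using (x∙yz≈y∙xz)
open import Data.Nat.Primality using (Prime)
open import Data.Bool using (Bool; true; false; _∧_; _∨_; if_then_else_)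
open import Data.Bool.Properties using (T-≡; ∧-comm; ∧-distribʳ-∨)
import Data.Bool as Bool
open import Data.Fin using (Fin; zero; suc; fromℕ; inject₁; _↑ˡ_; _↑ʳ_; _≟_)
open import Data.Fin.Properties using (splitAt-↑ˡ; splitAt-↑ʳ)
open import Data.List using ([]; _∷_; length; filter; tabulate; allFin)
open import Data.List.Relation.Unary.Any using (satisfied)
open import Data.List.Relation.Unary.Any.Properties using (any⁺; any⁻)
open import Data.List.Membership.Propositional using (lose)
open import Data.List.Membership.Propositional.Properties using (∈-allFin)
open import Data.Product using (_×_; _,_; ∃)
open import Data.Empty using (⊥-elim)
open import Function using (_∘_)
open import Function.Bundles using (Equivalence)
open import Function.Definitions using (Injective)
open import Relation.Unary using (Pred; Decidable)
open import Relation.Unary.Properties using (_∩?_)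
open import Relation.Nullary using (¬_; does; yes; no)
open import Relation.Nullary.Decidable using (⌊_⌋; _×-dec_; dec-true; dec-false; toWitness; fromWitness)
open import Relation.Binary.PropositionalEquality
  using (_≡_; _≢_; refl; sym; trans; cong; cong₂; module ≡-Reasoning)

toℕᵇ : Bool → ℕ
toℕᵇ true  = 1
toℕᵇ false = 0

count : ∀ {m} → (Fin m → Bool) → ℕ
count {zero}  p = 0
count {suc m} p = toℕᵇ (p zero) + count (p ∘ suc)

count-cong : ∀ {m} {p q : Fin m → Bool} → (∀ i → p i ≡ q i) → count p ≡ count q
count-cong {zero}  e = refl
count-cong {suc m} e = cong₂ _+_ (cong toℕᵇ (e zero)) (count-cong (e ∘ suc))

count-false : ∀ m → count {m} (λ _ → false) ≡ 0
count-false zero    = refl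
count-false (suc m) = count-false m

count-↑ : ∀ m n (p : Fin (m + n) → Bool) →
  count p ≡ count (λ i → p (i ↑ˡ n)) + count (λ i → p (m ↑ʳ i))
count-↑ zero    n p = refl
count-↑ (suc m) n p = begin
  toℕᵇ (p zero) + count (p ∘ suc)
    ≡⟨ cong (toℕᵇ (p zero) +_) (count-↑ m n (p ∘ suc)) ⟩
  toℕᵇ (p zero) + (count (λ i → p (suc (i ↑ˡ n))) + count (λ i → p (suc m ↑ʳ i)))
    ≡⟨ sym (+-assoc (toℕᵇ (p zero)) _ _) ⟩
  toℕᵇ (p zero) + count (λ i → p (suc (i ↑ˡ n))) + count (λ i → p (suc m ↑ʳ i)) ∎
  where open ≡-Reasoning

count-fromℕ : ∀ m (p : Fin (suc m) → Bool) →
  count p ≡ toℕᵇ (p (fromℕ m)) + count (p ∘ inject₁)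
count-fromℕ zero    p = refl
count-fromℕ (suc m) p = begin
  toℕᵇ (p zero) + count (p ∘ suc)
    ≡⟨ cong (toℕᵇ (p zero) +_) (count-fromℕ m (p ∘ suc)) ⟩
  toℕᵇ (p zero) + (toℕᵇ (p (fromℕ (suc m))) + count (p ∘ suc ∘ inject₁))
    ≡⟨ x∙yz≈y∙xz (toℕᵇ (p zero)) (toℕᵇ (p (fromℕ (suc m)))) (count (p ∘ suc ∘ inject₁)) ⟩
  toℕᵇ (p (fromℕ (suc m))) + (toℕᵇ (p zero) + count (p ∘ suc ∘ inject₁)) ∎
  where open ≡-Reasoning

count-∨ : ∀ {m} (p q : Fin m → Bool) → (∀ i → p i ∧ q i ≡ false) →
  count (λ i → p i ∨ q i) ≡ count p + count q
count-∨ {zero}  p q disj = refl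
count-∨ {suc m} p q disj
  with p zero | q zero | disj zero | count-∨ (p ∘ suc) (q ∘ suc) (disj ∘ suc)
... | true  | true  | () | _
... | true  | false | _ | ih = cong suc ih
... | false | true  | _ | ih = trans (cong suc ih) (sym (+-suc _ _))
... | false | false | _ | ih = ih

-- Counts are phrased with `does` rather than `⌊_⌋`: `does (suc i ≟ suc j)` reduces to
-- `does (i ≟ j)`, whereas `⌊ suc i ≟ suc j ⌋` is stuck.
count-≟ : ∀ {m} (a : Fin m) → count (λ i → does (i ≟ a)) ≡ 1
count-≟ {suc m} zero    = cong suc (count-false m)
count-≟ {suc m} (suc a) = count-≟ a

module _ {A : Set} where

  length-filter-tabulate : ∀ {m p} {P : Pred A p} (P? : Decidable P) (f : Fin m → A) →
    length (filter P? (tabulate f)) ≡ count (λ i → does (P? (f i)))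
  length-filter-tabulate {zero}  P? f = refl
  length-filter-tabulate {suc m} P? f with does (P? (f zero))
  ... | true  = cong suc (length-filter-tabulate P? (f ∘ suc))
  ... | false = length-filter-tabulate P? (f ∘ suc)

  length-filter-filter : ∀ {p q} {P : Pred A p} {Q : Pred A q} (P? : Decidable P) (Q? : Decidable Q) xs →
    length (filter Q? (filter P? xs)) ≡ length (filter (P? ∩? Q?) xs)
  length-filter-filter P? Q? []       = refl
  length-filter-filter P? Q? (x ∷ xs) with does (P? x)
  ... | false = length-filter-filter P? Q? xs
  ... | true  with does (Q? x)
  ...   | true  = cong suc (length-filter-filter P? Q? xs)
  ...   | false = length-filter-filter P? Q? xs

nbrCount≡count : ∀ {n m} (adj : Fin n → Fin n → Bool) (col : Fin n → Fin m) v c →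
  nbrCount adj col v c ≡ count (λ w → adj v w ∧ does (col w ≟ c))
nbrCount≡count {n} adj col v c = begin
  nbrCount adj col v c
    ≡⟨ length-filter-filter (λ w → col w ≟ c) (λ w → adj v w Bool.≟ true) (allFin n) ⟩
  length (filter (λ w → (col w ≟ c) ×-dec (adj v w Bool.≟ true)) (allFin n))
    ≡⟨ length-filter-tabulate (λ w → (col w ≟ c) ×-dec (adj v w Bool.≟ true)) (λ w → w) ⟩
  count (λ w → does (col w ≟ c) ∧ does (adj v w Bool.≟ true))
    ≡⟨ count-cong (λ w → trans (∧-comm (does (col w ≟ c)) _)
                                 (cong (_∧ does (col w ≟ c)) (does-≟-true (adj v w)))) ⟩
  count (λ w → adj v w ∧ does (col w ≟ c)) ∎
  where
  open ≡-Reasoning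
  does-≟-true : ∀ b → does (b Bool.≟ true) ≡ b
  does-≟-true true  = refl
  does-≟-true false = refl

classSize≡count : ∀ {n m} (col : Fin n → Fin m) c → classSize col c ≡ count (λ w → does (col w ≟ c))
classSize≡count col c = length-filter-tabulate (λ w → col w ≟ c) (λ w → w)

inImage-intro : ∀ {m n} (f : Fin m → Fin n) i → inImage f (f i) ≡ true
inImage-intro f i =
  Equivalence.to T-≡ (any⁺ (λ j → ⌊ f j ≟ f i ⌋) (lose (∈-allFin i) (fromWitness refl)))

inImage-elim : ∀ {m n} (f : Fin m → Fin n) x → inImage f x ≡ true → ∃ λ i → f i ≡ x
inImage-elim {m} f x e with satisfied (any⁻ (λ j → ⌊ f j ≟ x ⌋) (allFin m) (Equivalence.from T-≡ e))
... | i , fi≟x = i , toWitness fi≟x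

countVtx : ∀ {n k} → (Vtx n k → Bool) → ℕ
countVtx h = count (h ∘ old) + (toℕᵇ (h uV) + (count (h ∘ aV) + count (h ∘ a'V)))

count-decode : ∀ n k (h : Vtx n k → Bool) → count (h ∘ decode) ≡ countVtx h
count-decode n k h = begin
  count (h ∘ decode)
    ≡⟨ count-↑ n rest (h ∘ decode) ⟩
  count (h ∘ atOld) + (toℕᵇ (h (atNew zero)) + count (h ∘ atNew ∘ suc))
    ≡⟨ cong (λ z → count (h ∘ atOld) + (toℕᵇ (h (atNew zero)) + z))
         (count-↑ (2 * k) (2 * k) (h ∘ atNew ∘ suc)) ⟩
  count (h ∘ atOld) + (toℕᵇ (h (atNew zero)) + (count (h ∘ atA) + count (h ∘ atA')))
    ≡⟨ cong₂ _+_ (count-cong (cong h ∘ decode-old))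
         (cong₂ _+_ (cong (toℕᵇ ∘ h) decode-u)
           (cong₂ _+_ (count-cong (cong h ∘ decode-a)) (count-cong (cong h ∘ decode-a')))) ⟩
  countVtx h ∎
  where
  open ≡-Reasoning
  rest : ℕ
  rest = suc (2 * k + 2 * k)

  atOld : Fin n → Vtx n k
  atOld i = decode (i ↑ˡ rest)

  atNew : Fin rest → Vtx n k
  atNew s = decode (n ↑ʳ s)

  decode-old : ∀ i → atOld i ≡ old i
  decode-old i rewrite splitAt-↑ˡ n i rest = refl

  decode-u : atNew zero ≡ uV
  decode-u rewrite splitAt-↑ʳ n rest zero = refl

  atA atA' : Fin (2 * k) → Vtx n k
  atA  i = atNew (suc (i ↑ˡ 2 * k))
  atA' i = atNew (suc (2 * k ↑ʳ i))

  decode-a : ∀ i → atA i ≡ aV i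
  decode-a i rewrite splitAt-↑ʳ n rest (suc (i ↑ˡ 2 * k)) | splitAt-↑ˡ (2 * k) i (2 * k) = refl

  decode-a' : ∀ i → atA' i ≡ a'V i
  decode-a' i rewrite splitAt-↑ʳ n rest (suc (2 * k ↑ʳ i)) | splitAt-↑ʳ (2 * k) (2 * k) i = refl

toℕᵇ-+-double : ∀ b n → toℕᵇ b + n ≡ 1 → toℕᵇ b + (n + n) ≡ (if b then 1 else 2)
toℕᵇ-+-double true  zero       _ = refl
toℕᵇ-+-double false (suc zero) _ = refl

module VertexAddition (n k : ℕ) (adj : Fin n → Fin n → Bool) (col : Fin n → Fin (suc (2 * k)))
  (v v' : Fin (suc (2 * k)) → Fin n) (v≢v' : ∀ i j → v i ≢ v' j)
  (col∘v : ∀ i → col (v i) ≡ i) (col∘v' : ∀ i → col (v' i) ≡ i) where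

  open Addition n k adj col v v'

  adjV-sym : (∀ x y → adj x y ≡ adj y x) → ∀ X Y → adjV X Y ≡ adjV Y X
  adjV-sym symm (old x) (old y) = symm x y
  adjV-sym symm (old x) uV      = refl
  adjV-sym symm (old x) (aV _)  = refl
  adjV-sym symm (old x) (a'V _) = refl
  adjV-sym symm uV      (old y) = refl
  adjV-sym symm uV      uV      = refl
  adjV-sym symm uV      (aV _)  = refl
  adjV-sym symm uV      (a'V _) = refl
  adjV-sym symm (aV _)  (old y) = refl
  adjV-sym symm (aV _)  uV      = refl
  adjV-sym symm (aV _)  (aV _)  = refl
  adjV-sym symm (aV _)  (a'V _) = refl
  adjV-sym symm (a'V _) (old y) = refl
  adjV-sym symm (a'V _) uV      = refl
  adjV-sym symm (a'V _) (aV _)  = refl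
  adjV-sym symm (a'V _) (a'V _) = refl

  adjV-irrefl : (∀ x → adj x x ≡ false) → ∀ X → adjV X X ≡ false
  adjV-irrefl irr (old x) = irr x
  adjV-irrefl irr uV      = refl
  adjV-irrefl irr (aV _)  = refl
  adjV-irrefl irr (a'V _) = refl

  adj'-simple : IsSimple adj → IsSimple adj'
  adj'-simple (symm , irr) = (λ x y → adjV-sym symm (decode x) (decode y)) , adjV-irrefl irr ∘ decode

  inImage-∧-colour : ∀ (f : Fin (suc (2 * k)) → Fin n) → (∀ i → col (f i) ≡ i) →
    ∀ c y → inImage f y ∧ does (col y ≟ c) ≡ does (y ≟ f c)
  inImage-∧-colour f col∘f c y with y ≟ f c
  ... | yes refl rewrite inImage-intro f c | col∘f c = dec-true (c ≟ c) refl
  ... | no y≢fc with inImage f y in y∈f | col y ≟ c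
  ...   | false | _        = refl
  ...   | true  | no _     = refl
  ...   | true  | yes refl with inImage-elim f y y∈f
  ...     | i , refl = ⊥-elim (y≢fc (cong f (sym (col∘f i))))

  isNbrOfColour : Vtx n k → Fin (suc (2 * k)) → Vtx n k → Bool
  isNbrOfColour X c W = adjV X W ∧ does (colV W ≟ c)

  nbrCountVtx : Vtx n k → Fin (suc (2 * k)) → ℕ
  nbrCountVtx X c = countVtx (isNbrOfColour X c)

  nbrCount-adj' : ∀ x c → nbrCount adj' col' x c ≡ nbrCountVtx (decode x) c
  nbrCount-adj' x c = trans (nbrCount≡count adj' col' x c)
    (count-decode n k (isNbrOfColour (decode x) c))

  countVtx-old : ∀ (h : Vtx n k → Bool) → h uV ≡ false →
    (∀ i → h (aV i) ≡ false) → (∀ i → h (a'V i) ≡ false) → countVtx h ≡ count (h ∘ old)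
  countVtx-old h hu ha ha' = begin
    countVtx h
      ≡⟨ cong (count (h ∘ old) +_) (cong₂ _+_ (cong toℕᵇ hu)
           (cong₂ _+_ (trans (count-cong ha) (count-false (2 * k)))
                      (trans (count-cong ha') (count-false (2 * k))))) ⟩
    count (h ∘ old) + 0
      ≡⟨ +-identityʳ _ ⟩
    count (h ∘ old) ∎
    where open ≡-Reasoning

  count-inImage-colour : ∀ (f : Fin (suc (2 * k)) → Fin n) → (∀ i → col (f i) ≡ i) →
    ∀ c → count (λ y → inImage f y ∧ does (col y ≟ c)) ≡ 1
  count-inImage-colour f col∘f c = trans (count-cong (inImage-∧-colour f col∘f c)) (count-≟ (f c))

  nbrCountVtx-a : ∀ i c → nbrCountVtx (aV i) c ≡ 1
  nbrCountVtx-a i c = trans (countVtx-old (isNbrOfColour (aV i) c) refl (λ _ → refl) (λ _ → refl))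
    (count-inImage-colour v col∘v c)

  nbrCountVtx-a' : ∀ i c → nbrCountVtx (a'V i) c ≡ 1
  nbrCountVtx-a' i c = trans (countVtx-old (isNbrOfColour (a'V i) c) refl (λ _ → refl) (λ _ → refl))
    (count-inImage-colour v' col∘v' c)

  nbrCountVtx-u : ∀ c → nbrCountVtx uV c ≡ 2
  nbrCountVtx-u c = begin
    nbrCountVtx uV c
      ≡⟨ countVtx-old (isNbrOfColour uV c) refl (λ _ → refl) (λ _ → refl) ⟩
    count (λ y → (inImage v y ∨ inImage v' y) ∧ does (col y ≟ c))
      ≡⟨ count-cong (λ y → trans (∧-distribʳ-∨ _ (inImage v y) (inImage v' y))
           (cong₂ _∨_ (inImage-∧-colour v col∘v c y) (inImage-∧-colour v' col∘v' c y))) ⟩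
    count (λ y → does (y ≟ v c) ∨ does (y ≟ v' c))
      ≡⟨ count-∨ _ _ v≟∧v'≟ ⟩
    count (λ y → does (y ≟ v c)) + count (λ y → does (y ≟ v' c))
      ≡⟨ cong₂ _+_ (count-≟ (v c)) (count-≟ (v' c)) ⟩
    2 ∎
    where
    open ≡-Reasoning
    v≟∧v'≟ : ∀ y → does (y ≟ v c) ∧ does (y ≟ v' c) ≡ false
    v≟∧v'≟ y with y ≟ v c
    ... | yes refl = dec-false (v c ≟ v' c) (v≢v' c c)
    ... | no _     = refl

  newColour-once : ∀ c → toℕᵇ (does (fromℕ (2 * k) ≟ c)) + count (λ i → does (inject₁ i ≟ c)) ≡ 1
  newColour-once c = trans (sym (count-fromℕ (2 * k) (λ d → does (d ≟ c)))) (count-≟ c)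

  newNbrCount-old : ∀ x c →
    toℕᵇ ((inImage v x ∨ inImage v' x) ∧ does (fromℕ (2 * k) ≟ c))
      + (count (λ i → inImage v x ∧ does (inject₁ i ≟ c)) + count (λ i → inImage v' x ∧ does (inject₁ i ≟ c)))
    ≡ toℕᵇ (inImage v x ∨ inImage v' x)
  newNbrCount-old x c with inImage v x in x∈v | inImage v' x in x∈v'
  ... | true  | true  with inImage-elim v x x∈v | inImage-elim v' x x∈v'
  ...   | i , vi≡x | j , v'j≡x = ⊥-elim (v≢v' i j (trans vi≡x (sym v'j≡x)))
  newNbrCount-old x c | true  | false =
    trans (cong (toℕᵇ (does (fromℕ (2 * k) ≟ c)) +_)
            (trans (cong (count (λ i → does (inject₁ i ≟ c)) +_) (count-false (2 * k))) (+-identityʳ _)))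
          (newColour-once c)
  newNbrCount-old x c | false | true  =
    trans (cong (λ z → toℕᵇ (does (fromℕ (2 * k) ≟ c)) + (z + count (λ i → does (inject₁ i ≟ c))))
            (count-false (2 * k)))
          (newColour-once c)
  newNbrCount-old x c | false | false = cong₂ _+_ (count-false (2 * k)) (count-false (2 * k))

  nbrCountVtx-old : ∀ x c → nbrCountVtx (old x) c ≡ nbrCount adj col x c + toℕᵇ (inImage v x ∨ inImage v' x)
  nbrCountVtx-old x c = cong₂ _+_ (sym (nbrCount≡count adj col x c)) (newNbrCount-old x c)

  nbrCountVtx-balanced : IsBalanced adj col → ∀ X c c' → nbrCountVtx X c ≡ nbrCountVtx X c'
  nbrCountVtx-balanced bal (old x) c c' = begin
    nbrCountVtx (old x) c                                  ≡⟨ nbrCountVtx-old x c ⟩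
    nbrCount adj col x c + toℕᵇ (inImage v x ∨ inImage v' x)  ≡⟨ cong (_+ _) (bal x c c') ⟩
    nbrCount adj col x c' + toℕᵇ (inImage v x ∨ inImage v' x) ≡⟨ sym (nbrCountVtx-old x c') ⟩
    nbrCountVtx (old x) c'                                 ∎
    where open ≡-Reasoning
  nbrCountVtx-balanced _ uV      c c' = trans (nbrCountVtx-u c) (sym (nbrCountVtx-u c'))
  nbrCountVtx-balanced _ (aV i)  c c' = trans (nbrCountVtx-a i c) (sym (nbrCountVtx-a i c'))
  nbrCountVtx-balanced _ (a'V i) c c' = trans (nbrCountVtx-a' i c) (sym (nbrCountVtx-a' i c'))

  col'-balanced : IsBalanced adj col → IsBalanced adj' col'
  col'-balanced bal x c c' =
    trans (nbrCount-adj' x c) (trans (nbrCountVtx-balanced bal (decode x) c c') (sym (nbrCount-adj' x c')))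

  classSize-col' : ∀ c → classSize col' c ≡ classSize col c + (if does (fromℕ (2 * k) ≟ c) then 1 else 2)
  classSize-col' c = begin
    classSize col' c
      ≡⟨ classSize≡count col' c ⟩
    count (λ w → does (col' w ≟ c))
      ≡⟨ count-decode n k (λ W → does (colV W ≟ c)) ⟩
    count (λ y → does (col y ≟ c)) + (toℕᵇ (does (fromℕ (2 * k) ≟ c)) + (newCount + newCount))
      ≡⟨ cong₂ _+_ (sym (classSize≡count col c)) (toℕᵇ-+-double _ newCount (newColour-once c)) ⟩
    classSize col c + (if does (fromℕ (2 * k) ≟ c) then 1 else 2) ∎
    where
    open ≡-Reasoning
    newCount : ℕ
    newCount = count (λ i → does (inject₁ i ≟ c))

  classSize-col'-last : classSize col' (fromℕ (2 * k)) ≡ classSize col (fromℕ (2 * k)) + 1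
  classSize-col'-last = trans (classSize-col' (fromℕ (2 * k)))
    (cong (λ b → classSize col (fromℕ (2 * k)) + (if b then 1 else 2))
          (dec-true (fromℕ (2 * k) ≟ fromℕ (2 * k)) refl))

  classSize-col'-other : ∀ c → c ≢ fromℕ (2 * k) → classSize col' c ≡ classSize col c + 2
  classSize-col'-other c c≢last = trans (classSize-col' c)
    (cong (λ b → classSize col c + (if b then 1 else 2)) (dec-false (fromℕ (2 * k) ≟ c) (c≢last ∘ sym)))

proposition2p19 : (k : ℕ) → 1 Data.Nat.≤ k → Prime (suc (2 * k)) →
    (n : ℕ) (adj : Fin n → Fin n → Bool) (col : Fin n → Fin (suc (2 * k))) →
    IsSimple adj → IsBalanced adj col →
    (v v' : Fin (suc (2 * k)) → Fin n) →
    Injective _≡_ _≡_ v → Injective _≡_ _≡_ v' → (∀ i j → v i ≢ v' j) →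
    (∀ i → col (v i) ≡ i) → (∀ i → col (v' i) ≡ i) →
    IsSimple (Addition.adj' n k adj col v v')
      × IsBalanced (Addition.adj' n k adj col v v') (Addition.col' n k adj col v v')
      × (classSize (Addition.col' n k adj col v v') (fromℕ (2 * k)) ≡ classSize col (fromℕ (2 * k)) + 1)
      × (∀ c → ¬ (c ≡ fromℕ (2 * k)) → classSize (Addition.col' n k adj col v v') c ≡ classSize col c + 2)
proposition2p19 k _ _ n adj col simple balanced v v' _ _ v≢v' col∘v col∘v' =
  adj'-simple simple , col'-balanced balanced , classSize-col'-last , classSize-col'-other
  where open VertexAddition n k adj col v v' v≢v' col∘v col∘v'
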